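{- Let $n \ge 1$, $1 \le q \le n$ and $2 \le k \le 2^n$. Define $F_0(k) = k$ for $1 \le k \le 2^n$, and for $1 \le p \le n$ define $F_p$ on $[1:2^n]$ inductively by $F_p(1) = 0$ and, for $m \ge 2$, $F_p(m) = \max_{1 \le m' \le m/2}\bigl(F_p(m') + F_p(m-m') + F_{p-1}(m')\bigr)$. Let $(k-k_1, k_1)$ with $1 \le k_1 \le k/2$ be a hypercubic partition of $k$. Then $k' = k_1$ is a maximizer of $F_q(k') + F_q(k-k') + F_{q-1}(k')$ subject to $1 \le k' \le k/2$; that is, $F_q(k) = F_q(k-k_1) + F_q(k_1) + F_{q-1}(k_1)$.
   Context: For integers $a,b$, $[a:b]=\{a,\ldots,b\}$. A pair $(k-k_1, k_1)$ with $1 \le k_1 \le k/2$ is called a hypercubic partition of $k$ (where $k \le 2^n$) if there exists a bit position $r \in [0:n-1]$ such that exactly $k_1$ of the numbers $0, 1, \ldots, k-1$ have a $1$ in bit position $r$ of their binary representation (bit position $0$ being the least significant bit). -}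

module Defs where

open import Data.Nat using (ℕ; zero; suc; _+_; _*_; _∸_; _^_; _≤_; _<_; _⊔_; _≤ᵇ_; ⌊_/2⌋; _%_)
open import Data.Bool using (if_then_else_)
open import Data.Product using (_×_; ∃-syntax)
open import Relation.Binary.PropositionalEquality using (_≡_)

-- maxFrom1 f j = max_{1 ≤ m' ≤ j} f m'   (0 if j = 0; all values are ≥ 0 anyway)
maxFrom1 : (ℕ → ℕ) → ℕ → ℕ
maxFrom1 f zero    = 0
maxFrom1 f (suc j) = maxFrom1 f j ⊔ f (suc j)

-- F p m, as in the paper:  F_0(m) = m;  F_p(1) = 0;
-- F_p(m) = max_{1 ≤ m' ≤ m/2} (F_p(m') + F_p(m - m') + F_{p-1}(m'))  for m ≥ 2.
-- The recursion on m is implemented with fuel (fuel ≥ m suffices, since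
-- m' < m and m - m' < m for 1 ≤ m' ≤ m/2).
mutual
  F : ℕ → ℕ → ℕ
  F zero    m = m
  F (suc p) m = Fuel p m m

  Fuel : ℕ → ℕ → ℕ → ℕ
  Fuel p zero       m = 0
  Fuel p (suc fuel) m =
    if m ≤ᵇ 1 then 0
    else maxFrom1 (λ m' → Fuel p fuel m' + Fuel p fuel (m ∸ m') + F p m') ⌊ m /2⌋

shiftR : ℕ → ℕ → ℕ
shiftR zero    i = i
shiftR (suc r) i = shiftR r ⌊ i /2⌋

bit : ℕ → ℕ → ℕ
bit r i = shiftR r i % 2

countOnes : ℕ → ℕ → ℕ
countOnes r zero    = 0
countOnes r (suc k) = countOnes r k + bit r k

HypercubicPartition : ℕ → ℕ → ℕ → Set
HypercubicPartition n k k₁ =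
  1 ≤ k₁ × 2 * k₁ ≤ k × ∃[ r ] (r < n × countOnes r k ≡ k₁)

-- F q m is the number of q-dimensional subcubes of the hypercube all of whose
-- vertices lie in {0, …, m - 1}, namely Σ_{i<m} C(popcount i, q).  Splitting an
-- initial segment into its even and odd elements writes it as two initial
-- segments of sizes ⌈ m /2⌉ and ⌊ m /2⌋ joined along direction 0, which attains
-- the maximum in the recursion; no other split does better, by induction on the
-- halves of both parts.  Splitting {0, …, k - 1} by bit r instead of bit 0 gives
-- (after deleting bit r) initial segments of sizes k - k₁ and k₁ joined along
-- direction r, so F q k is also the value of that split.
module Submission where

open import Defs
open import Data.Nat using (ℕ; zero; suc; _+_; _∸_; _^_; _≤_; _<_; _⊔_; _%_; ⌊_/2⌋; ⌈_/2⌉; s≤s; z≤n)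
open import Data.Nat.Combinatorics using (_C_; nCk+nC[k+1]≡[n+1]C[k+1])
open import Data.Nat.DivMod using (m%n<n)
open import Data.Nat.Induction using (<-wellFounded)
open import Data.Nat.Properties
open import Data.Nat.Tactic.RingSolver using (solve-∀)
open import Data.Product using (_×_; _,_; proj₁; proj₂)
open import Data.Sum using (inj₁; inj₂)
open import Induction.WellFounded using (Acc; acc)
open import Relation.Binary.PropositionalEquality

+-cong₃ : ∀ {a b c d e f} → a ≡ d → b ≡ e → c ≡ f → a + b + c ≡ d + e + f
+-cong₃ refl refl refl = refl

+-mono₃-≤ : ∀ {a b c d e f} → a ≤ d → b ≤ e → c ≤ f → a + b + c ≤ d + e + f
+-mono₃-≤ a≤d b≤e c≤f = +-mono-≤ (+-mono-≤ a≤d b≤e) c≤f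

data EvenOdd : ℕ → Set where
  even : ∀ x → EvenOdd (x + x)
  odd  : ∀ x → EvenOdd (suc (x + x))

evenOdd : ∀ n → EvenOdd n
evenOdd zero          = even 0
evenOdd (suc zero)    = odd 0
evenOdd (suc (suc n)) with evenOdd n
... | even x = subst EvenOdd (cong suc (+-suc x x)) (even (suc x))
... | odd x  = subst EvenOdd (cong (λ t → suc (suc t)) (+-suc x x)) (odd (suc x))

[n+n]%2≡0 : ∀ n → (n + n) % 2 ≡ 0
[n+n]%2≡0 zero    = refl
[n+n]%2≡0 (suc n) rewrite +-suc n n = [n+n]%2≡0 n

[1+n+n]%2≡1 : ∀ n → suc (n + n) % 2 ≡ 1
[1+n+n]%2≡1 zero    = refl
[1+n+n]%2≡1 (suc n) rewrite +-suc n n = [1+n+n]%2≡1 n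

%2+[1+n]%2≡1 : ∀ n → n % 2 + suc n % 2 ≡ 1
%2+[1+n]%2≡1 zero          = refl
%2+[1+n]%2≡1 (suc zero)    = refl
%2+[1+n]%2≡1 (suc (suc n)) = %2+[1+n]%2≡1 n

⌈n/2⌉+⌊n/2⌋≡n : ∀ n → ⌈ n /2⌉ + ⌊ n /2⌋ ≡ n
⌈n/2⌉+⌊n/2⌋≡n n = trans (+-comm ⌈ n /2⌉ ⌊ n /2⌋) (⌊n/2⌋+⌈n/2⌉≡n n)

m+m≤1+n+n⇒m≤n : ∀ {m n} → m + m ≤ suc (n + n) → m ≤ n
m+m≤1+n+n⇒m≤n {m} {n} h = subst₂ _≤_ (sym (n≡⌊n+n/2⌋ m)) (sym (n≡⌈n+n/2⌉ n)) (⌊n/2⌋-mono h)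

m≤⌊n/2⌋⇒m≤n∸m : ∀ {m} n → m ≤ ⌊ n /2⌋ → m ≤ n ∸ m
m≤⌊n/2⌋⇒m≤n∸m {m} n m≤half = m+n≤o⇒m≤o∸n m (begin
  m + m                 ≤⟨ +-mono-≤ m≤half (≤-trans m≤half (⌊n/2⌋≤⌈n/2⌉ n)) ⟩
  ⌊ n /2⌋ + ⌈ n /2⌉     ≡⟨ ⌊n/2⌋+⌈n/2⌉≡n n ⟩
  n                     ∎)
  where open ≤-Reasoning

[m+n]∸[o+p]≡[m∸o]+[n∸p] : ∀ {m n o p} → o ≤ m → p ≤ n → (m + n) ∸ (o + p) ≡ (m ∸ o) + (n ∸ p)
[m+n]∸[o+p]≡[m∸o]+[n∸p] {m} {n} {o} {p} o≤m p≤n = begin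
  (m + n) ∸ (o + p)     ≡⟨ ∸-+-assoc (m + n) o p ⟨
  (m + n) ∸ o ∸ p       ≡⟨ cong (_∸ p) (+-∸-comm n o≤m) ⟩
  (m ∸ o) + n ∸ p       ≡⟨ +-∸-assoc (m ∸ o) p≤n ⟩
  (m ∸ o) + (n ∸ p)     ∎
  where open ≡-Reasoning

data Balanced : ℕ → ℕ → Set where
  equal   : ∀ {x} → Balanced x x
  oneMore : ∀ {x} → Balanced (suc x) x

balanced-suc : ∀ {h l} → Balanced h l → Balanced (suc h) (suc l)
balanced-suc equal   = equal
balanced-suc oneMore = oneMore

balanced-halves : ∀ k → Balanced ⌈ k /2⌉ ⌊ k /2⌋
balanced-halves zero          = equal
balanced-halves (suc zero)    = oneMore
balanced-halves (suc (suc k)) = balanced-suc (balanced-halves k)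

-- Enough fuel is i itself, as halving reaches 0 within i steps.
popcountWith : ℕ → ℕ → ℕ
popcountWith zero    i = 0
popcountWith (suc f) i = i % 2 + popcountWith f ⌊ i /2⌋

popcount : ℕ → ℕ
popcount i = popcountWith i i

popcountWith-zero : ∀ f → popcountWith f 0 ≡ 0
popcountWith-zero zero    = refl
popcountWith-zero (suc f) = popcountWith-zero f

popcountWith-fuel : ∀ {f g} i → i ≤ f → i ≤ g → popcountWith f i ≡ popcountWith g i
popcountWith-fuel {zero}  {g}     zero    _         _         = sym (popcountWith-zero g)
popcountWith-fuel {suc f} {zero}  zero    _         _         = popcountWith-zero (suc f)
popcountWith-fuel {suc f} {suc g} zero    _         _         = popcountWith-fuel {f} {g} 0 z≤n z≤n
popcountWith-fuel {suc f} {suc g} (suc i) (s≤s i≤f) (s≤s i≤g) =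
  cong (suc i % 2 +_) (popcountWith-fuel ⌊ suc i /2⌋ (≤-trans half≤i i≤f) (≤-trans half≤i i≤g))
  where half≤i = ≤-pred (⌊n/2⌋<n i)

popcount-double : ∀ x → popcount (x + x) ≡ popcount x
popcount-double zero    = refl
popcount-double (suc x) = begin
  (suc x + suc x) % 2 + popcountWith (x + suc x) ⌊ suc x + suc x /2⌋
    ≡⟨ cong₂ _+_ ([n+n]%2≡0 (suc x)) (cong (popcountWith (x + suc x)) (sym (n≡⌊n+n/2⌋ (suc x)))) ⟩
  popcountWith (x + suc x) (suc x)
    ≡⟨ popcountWith-fuel (suc x) (m≤n+m (suc x) x) ≤-refl ⟩
  popcount (suc x) ∎
  where open ≡-Reasoning

popcount-double+1 : ∀ x → popcount (suc (x + x)) ≡ suc (popcount x)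
popcount-double+1 x = begin
  suc (x + x) % 2 + popcountWith (x + x) ⌊ suc (x + x) /2⌋
    ≡⟨ cong₂ _+_ ([1+n+n]%2≡1 x) (cong (popcountWith (x + x)) (sym (n≡⌈n+n/2⌉ x))) ⟩
  suc (popcountWith (x + x) x)
    ≡⟨ cong suc (popcountWith-fuel x (m≤m+n x x) ≤-refl) ⟩
  suc (popcount x) ∎
  where open ≡-Reasoning

_C⁻_ : ℕ → ℕ → ℕ
s C⁻ zero  = 0
s C⁻ suc q = s C q

C⁻-pascal : ∀ s p → suc s C⁻ p ≡ s C⁻ p + s C⁻ (p ∸ 1)
C⁻-pascal s zero          = refl
C⁻-pascal s (suc zero)    = refl
C⁻-pascal s (suc (suc q)) = trans (sym (nCk+nC[k+1]≡[n+1]C[k+1] s q)) (+-comm (s C q) (s C suc q))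

-- cubes (suc q) m counts the q-dimensional subcubes with all vertices below m by
-- their top vertex i, which tops popcount i C q of them.  The shift in p makes
-- cubes 0 = 0, so the identities below hold uniformly in p, with F (q - 1)
-- becoming cubes (p ∸ 1).
cubes : ℕ → ℕ → ℕ
cubes p zero    = 0
cubes p (suc m) = cubes p m + popcount m C⁻ p

splitCubes : ℕ → ℕ → ℕ → ℕ
splitCubes p u c = cubes p u + cubes p c + cubes (p ∸ 1) c

cubes-one : ∀ m → cubes 1 m ≡ m
cubes-one zero    = refl
cubes-one (suc m) = trans (cong (_+ 1) (cubes-one m)) (+-comm m 1)

cubes-mono : ∀ p m → cubes p m ≤ cubes p (suc m)
cubes-mono p m = m≤m+n (cubes p m) (popcount m C⁻ p)

cubes-double : ∀ p x → cubes p (x + x) ≡ splitCubes p x x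
cubes-double p zero    = refl
cubes-double p (suc x) = begin
  cubes p (suc x + suc x)
    ≡⟨ cong (λ t → cubes p (suc t)) (+-suc x x) ⟩
  cubes p (x + x) + popcount (x + x) C⁻ p + popcount (suc (x + x)) C⁻ p
    ≡⟨ cong₂ (λ s t → cubes p (x + x) + s C⁻ p + t C⁻ p) (popcount-double x) (popcount-double+1 x) ⟩
  cubes p (x + x) + popcount x C⁻ p + suc (popcount x) C⁻ p
    ≡⟨ cong₂ (λ a b → a + popcount x C⁻ p + b) (cubes-double p x) (C⁻-pascal (popcount x) p) ⟩
  splitCubes p x x + w + (w + popcount x C⁻ (p ∸ 1))
    ≡⟨ regroup (cubes p x) (cubes (p ∸ 1) x) w (popcount x C⁻ (p ∸ 1)) ⟩
  splitCubes p (suc x) (suc x) ∎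
  where
  open ≡-Reasoning
  w = popcount x C⁻ p
  regroup : ∀ a b c d → a + a + b + c + (c + d) ≡ (a + c) + (a + c) + (b + d)
  regroup = solve-∀

cubes-double+1 : ∀ p x → cubes p (suc x + x) ≡ splitCubes p (suc x) x
cubes-double+1 p x = begin
  cubes p (x + x) + popcount (x + x) C⁻ p
    ≡⟨ cong₂ (λ a s → a + s C⁻ p) (cubes-double p x) (popcount-double x) ⟩
  splitCubes p x x + popcount x C⁻ p
    ≡⟨ regroup (cubes p x) (cubes (p ∸ 1) x) (popcount x C⁻ p) ⟩
  splitCubes p (suc x) x ∎
  where
  open ≡-Reasoning
  regroup : ∀ a b c → a + a + b + c ≡ (a + c) + a + b
  regroup = solve-∀

cubes-balanced : ∀ p {h l} → Balanced h l → cubes p (h + l) ≡ splitCubes p h l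
cubes-balanced p {x}     equal   = cubes-double p x
cubes-balanced p {_} {x} oneMore = cubes-double+1 p x

SplitBounded : ℕ → ℕ → ℕ → Set
SplitBounded p u c = splitCubes p u c ≤ cubes p (u + c)

double-+ : ∀ y x → (y + x) + (y + x) ≡ (y + y) + (x + x)
double-+ = solve-∀

-- In each parity case both sides are expanded by the halving identities and the
-- halves of u are paired with those of c.
splitBounded-even-even : ∀ p {y x} → SplitBounded p y x → SplitBounded (p ∸ 1) y x →
  SplitBounded p (y + y) (x + x)
splitBounded-even-even p {y} {x} b b′ = begin
  splitCubes p (y + y) (x + x)
    ≡⟨ +-cong₃ (cubes-double p y) (cubes-double p x) (cubes-double (p ∸ 1) x) ⟩
  splitCubes p y y + splitCubes p x x + splitCubes (p ∸ 1) x x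
    ≡⟨ regroup (cubes p y) (cubes p x) (cubes (p ∸ 1) y) (cubes (p ∸ 1) x) (cubes (p ∸ 1 ∸ 1) x) ⟩
  splitCubes p y x + splitCubes p y x + splitCubes (p ∸ 1) y x
    ≤⟨ +-mono₃-≤ b b b′ ⟩
  splitCubes p (y + x) (y + x)
    ≡⟨ cubes-double p (y + x) ⟨
  cubes p ((y + x) + (y + x))
    ≡⟨ cong (cubes p) (double-+ y x) ⟩
  cubes p ((y + y) + (x + x)) ∎
  where
  open ≤-Reasoning
  regroup : ∀ a b c d e → (a + a + c) + (b + b + d) + (d + d + e) ≡ (a + b + d) + (a + b + d) + (c + d + e)
  regroup = solve-∀

splitBounded-odd-even : ∀ p {y x} → SplitBounded p (suc y) x → SplitBounded p y x → SplitBounded (p ∸ 1) y x →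
  SplitBounded p (suc (y + y)) (x + x)
splitBounded-odd-even p {y} {x} b₁ b₀ b′ = begin
  splitCubes p (suc y + y) (x + x)
    ≡⟨ +-cong₃ (cubes-double+1 p y) (cubes-double p x) (cubes-double (p ∸ 1) x) ⟩
  splitCubes p (suc y) y + splitCubes p x x + splitCubes (p ∸ 1) x x
    ≡⟨ regroup (cubes p (suc y)) (cubes p y) (cubes p x) (cubes (p ∸ 1) y) (cubes (p ∸ 1) x) (cubes (p ∸ 1 ∸ 1) x) ⟩
  splitCubes p (suc y) x + splitCubes p y x + splitCubes (p ∸ 1) y x
    ≤⟨ +-mono₃-≤ b₁ b₀ b′ ⟩
  splitCubes p (suc (y + x)) (y + x)
    ≡⟨ cubes-double+1 p (y + x) ⟨
  cubes p (suc (y + x) + (y + x))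
    ≡⟨ cong (λ t → cubes p (suc t)) (double-+ y x) ⟩
  cubes p (suc (y + y) + (x + x)) ∎
  where
  open ≤-Reasoning
  regroup : ∀ a′ a b c d e → (a′ + a + c) + (b + b + d) + (d + d + e) ≡ (a′ + b + d) + (a + b + d) + (c + d + e)
  regroup = solve-∀

splitBounded-even-odd : ∀ p {y x} → SplitBounded p y (suc x) → SplitBounded p y x → SplitBounded (p ∸ 1) y x →
  SplitBounded p (y + y) (suc (x + x))
splitBounded-even-odd p {y} {x} b₁ b₀ b′ = begin
  splitCubes p (y + y) (suc x + x)
    ≡⟨ +-cong₃ (cubes-double p y) (cubes-double+1 p x) (cubes-double+1 (p ∸ 1) x) ⟩
  splitCubes p y y + splitCubes p (suc x) x + splitCubes (p ∸ 1) (suc x) x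
    ≡⟨ regroup (cubes p y) (cubes p (suc x)) (cubes p x) (cubes (p ∸ 1) y) (cubes (p ∸ 1) (suc x)) (cubes (p ∸ 1) x) (cubes (p ∸ 1 ∸ 1) x) ⟩
  splitCubes p y (suc x) + splitCubes p y x + splitCubes (p ∸ 1) y x
    ≤⟨ +-mono₃-≤ b₁ b₀ b′ ⟩
  splitCubes p (y + suc x) (y + x)
    ≡⟨ cong (λ t → splitCubes p t (y + x)) (+-suc y x) ⟩
  splitCubes p (suc (y + x)) (y + x)
    ≡⟨ cubes-double+1 p (y + x) ⟨
  cubes p (suc (y + x) + (y + x))
    ≡⟨ cong (cubes p) (trans (cong suc (double-+ y x)) (sym (+-suc (y + y) (x + x)))) ⟩
  cubes p ((y + y) + suc (x + x)) ∎
  where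
  open ≤-Reasoning
  regroup : ∀ a b′ b c d′ d e → (a + a + c) + (b′ + b + d) + (d′ + d + e) ≡ (a + b′ + d′) + (a + b + d) + (c + d + e)
  regroup = solve-∀

splitBounded-odd-odd : ∀ p {y x} → SplitBounded p y (suc x) → SplitBounded p (suc y) x → SplitBounded (p ∸ 1) y x →
  SplitBounded p (suc (y + y)) (suc (x + x))
splitBounded-odd-odd p {y} {x} b₁ b₂ b′ = begin
  splitCubes p (suc y + y) (suc x + x)
    ≡⟨ +-cong₃ (cubes-double+1 p y) (cubes-double+1 p x) (cubes-double+1 (p ∸ 1) x) ⟩
  splitCubes p (suc y) y + splitCubes p (suc x) x + splitCubes (p ∸ 1) (suc x) x
    ≡⟨ regroup (cubes p (suc y)) (cubes p y) (cubes p (suc x)) (cubes p x)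
               (cubes (p ∸ 1) y) (cubes (p ∸ 1) (suc x)) (cubes (p ∸ 1) x) (cubes (p ∸ 1 ∸ 1) x) ⟩
  splitCubes p y (suc x) + splitCubes p (suc y) x + splitCubes (p ∸ 1) y x
    ≤⟨ +-mono₃-≤ b₁ b₂ (≤-trans b′ (cubes-mono (p ∸ 1) (y + x))) ⟩
  cubes p (y + suc x) + cubes p (suc y + x) + cubes (p ∸ 1) (suc (y + x))
    ≡⟨ cong (λ t → cubes p t + cubes p (suc (y + x)) + cubes (p ∸ 1) (suc (y + x))) (+-suc y x) ⟩
  splitCubes p (suc (y + x)) (suc (y + x))
    ≡⟨ cubes-double p (suc (y + x)) ⟨
  cubes p (suc (y + x) + suc (y + x))
    ≡⟨ cong (cubes p) (double-suc-+ y x) ⟩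
  cubes p (suc (y + y) + suc (x + x)) ∎
  where
  open ≤-Reasoning
  regroup : ∀ a′ a b′ b c d′ d e →
    (a′ + a + c) + (b′ + b + d) + (d′ + d + e) ≡ (a + b′ + d′) + (a′ + b + d) + (c + d + e)
  regroup = solve-∀
  double-suc-+ : ∀ y x → suc (y + x) + suc (y + x) ≡ suc (y + y) + suc (x + x)
  double-suc-+ = solve-∀

splitBounded-zero : ∀ p u → SplitBounded p u 0
splitBounded-zero p u = ≤-reflexive (begin
  cubes p u + 0 + 0 ≡⟨ +-identityʳ (cubes p u + 0) ⟩
  cubes p u + 0     ≡⟨ +-identityʳ (cubes p u) ⟩
  cubes p u         ≡⟨ cong (cubes p) (+-identityʳ u) ⟨
  cubes p (u + 0)   ∎)
  where open ≡-Reasoning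

-- Well-founded induction on the larger part u, recursing on the halves of u and c.
-- Equal odd parts are settled directly by cubes-double (for u = c = 1 the halves
-- would not be smaller).
splitBounded : ∀ p {u c} → c ≤ u → SplitBounded p u c
splitBounded p c≤u = go p (<-wellFounded _) c≤u
  where
  y<y+y : ∀ {x y} → x < y → y < y + y
  y<y+y {y = y} x<y = m<m+n y (m<n⇒0<n x<y)

  y<1+y+y : ∀ y → y < suc (y + y)
  y<1+y+y y = s≤s (m≤m+n y y)

  1+y<1+y+y : ∀ {x y} → x < y → suc y < suc (y + y)
  1+y<1+y+y x<y = s≤s (y<y+y x<y)

  go : ∀ p {u c} → Acc _<_ u → c ≤ u → SplitBounded p u c
  go p {u} {c} (acc rec) c≤u with evenOdd u | evenOdd c
  ... | _ | even zero = splitBounded-zero p u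
  ... | even y | even (suc x) =
    splitBounded-even-even p {y} {suc x} (go p (rec (y<y+y x<y)) x<y) (go (p ∸ 1) (rec (y<y+y x<y)) x<y)
    where x<y = m+m≤1+n+n⇒m≤n {suc x} {y} (m≤n⇒m≤1+n c≤u)
  ... | odd y | even (suc x) =
    splitBounded-odd-even p {y} {suc x} (go p (rec (1+y<1+y+y x<y)) (m≤n⇒m≤1+n x<y))
      (go p (rec (y<1+y+y y)) x<y) (go (p ∸ 1) (rec (y<1+y+y y)) x<y)
    where x<y = m+m≤1+n+n⇒m≤n {suc x} {y} c≤u
  ... | even y | odd x =
    splitBounded-even-odd p {y} {x} (go p (rec (y<y+y x<y)) x<y)
      (go p (rec (y<y+y x<y)) (<⇒≤ x<y)) (go (p ∸ 1) (rec (y<y+y x<y)) (<⇒≤ x<y))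
    where x<y = m+m≤1+n+n⇒m≤n {suc x} {y} (subst (_≤ suc (y + y)) (cong suc (sym (+-suc x x))) (s≤s c≤u))
  ... | odd y | odd x with m≤n⇒m<n∨m≡n (m+m≤1+n+n⇒m≤n {x} {y} (m≤n⇒m≤1+n (≤-pred c≤u)))
  ...   | inj₂ refl = ≤-reflexive (sym (cubes-double p (suc (y + y))))
  ...   | inj₁ x<y =
    splitBounded-odd-odd p {y} {x} (go p (rec (y<1+y+y y)) x<y)
      (go p (rec (1+y<1+y+y x<y)) (m≤n⇒m≤1+n (<⇒≤ x<y))) (go (p ∸ 1) (rec (y<1+y+y y)) (<⇒≤ x<y))

Splits : ℕ → ℕ → ℕ → Set
Splits p k c = cubes p k ≡ splitCubes p (k ∸ c) c

balanced-splits : ∀ p {h l} → Balanced h l → Splits p (h + l) l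
balanced-splits p {h} {l} hl = trans (cubes-balanced p hl) (cong (λ t → splitCubes p t l) (sym (m+n∸n≡m h l)))

splits-half : ∀ p m → Splits p m ⌊ m /2⌋
splits-half p m = subst (λ k → Splits p k ⌊ m /2⌋) (⌈n/2⌉+⌊n/2⌋≡n m) (balanced-splits p (balanced-halves m))

maxFrom1-lub : ∀ f j {X} → (∀ {i} → 1 ≤ i → i ≤ j → f i ≤ X) → maxFrom1 f j ≤ X
maxFrom1-lub f zero    bound = z≤n
maxFrom1-lub f (suc j) bound =
  ⊔-lub (maxFrom1-lub f j (λ 1≤i i≤j → bound 1≤i (m≤n⇒m≤1+n i≤j))) (bound (s≤s z≤n) ≤-refl)

maxFrom1-cong : ∀ {f g} j → (∀ {i} → 1 ≤ i → i ≤ j → f i ≡ g i) → maxFrom1 f j ≡ maxFrom1 g j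
maxFrom1-cong zero    eq = refl
maxFrom1-cong (suc j) eq =
  cong₂ _⊔_ (maxFrom1-cong j (λ 1≤i i≤j → eq 1≤i (m≤n⇒m≤1+n i≤j))) (eq (s≤s z≤n) ≤-refl)

cubes-recursion : ∀ p m → let M = suc (suc m) in
  maxFrom1 (λ i → cubes p i + cubes p (M ∸ i) + cubes (p ∸ 1) i) ⌊ M /2⌋ ≡ cubes p M
cubes-recursion p m = ≤-antisym
  (maxFrom1-lub split ⌊ M /2⌋ λ {i} _ i≤half →
    let i≤M∸i = m≤⌊n/2⌋⇒m≤n∸m M i≤half in begin
      split i                        ≡⟨ split-swap i ⟩
      splitCubes p (M ∸ i) i         ≤⟨ splitBounded p i≤M∸i ⟩
      cubes p (M ∸ i + i)            ≡⟨ cong (cubes p) (m∸n+n≡m (≤-trans i≤M∸i (m∸n≤m M i))) ⟩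
      cubes p M                      ∎)
  (begin
    cubes p M                        ≡⟨ splits-half p M ⟩
    splitCubes p (M ∸ ⌊ M /2⌋) ⌊ M /2⌋ ≡⟨ split-swap ⌊ M /2⌋ ⟨
    split ⌊ M /2⌋                    ≤⟨ m≤n⊔m (maxFrom1 split ⌊ m /2⌋) (split ⌊ M /2⌋) ⟩
    maxFrom1 split ⌊ M /2⌋           ∎)
  where
  open ≤-Reasoning
  M = suc (suc m)
  split : ℕ → ℕ
  split i = cubes p i + cubes p (M ∸ i) + cubes (p ∸ 1) i
  split-swap : ∀ i → split i ≡ splitCubes p (M ∸ i) i
  split-swap i = cong (_+ cubes (p ∸ 1) i) (+-comm (cubes p i) (cubes p (M ∸ i)))

mutual
  F≡cubes : ∀ q m → F q m ≡ cubes (suc q) m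
  F≡cubes zero    m = sym (cubes-one m)
  F≡cubes (suc q) m = Fuel≡cubes q m m ≤-refl

  Fuel≡cubes : ∀ q fuel m → m ≤ fuel → Fuel q fuel m ≡ cubes (suc (suc q)) m
  Fuel≡cubes q zero       zero          _         = refl
  Fuel≡cubes q (suc fuel) zero          _         = refl
  Fuel≡cubes q (suc fuel) (suc zero)    _         = refl
  Fuel≡cubes q (suc fuel) (suc (suc m)) (s≤s m<fuel) =
    trans (maxFrom1-cong ⌊ M /2⌋ agree) (cubes-recursion (suc (suc q)) m)
    where
    M = suc (suc m)
    agree : ∀ {i} → 1 ≤ i → i ≤ ⌊ M /2⌋ →
      Fuel q fuel i + Fuel q fuel (M ∸ i) + F q i ≡ cubes (suc (suc q)) i + cubes (suc (suc q)) (M ∸ i) + cubes (suc q) i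
    agree {suc i} _ i<half = +-cong₃
      (Fuel≡cubes q fuel (suc i) (≤-trans i<half (≤-trans (s≤s (⌊n/2⌋≤n m)) m<fuel)))
      (Fuel≡cubes q fuel (suc m ∸ i) (≤-trans (m∸n≤m (suc m) i) m<fuel))
      (F≡cubes q (suc i))

bit<2 : ∀ r i → bit r i < 2
bit<2 r i = m%n<n (shiftR r i) 2

countOnes≤ : ∀ r k → countOnes r k ≤ k
countOnes≤ r zero    = z≤n
countOnes≤ r (suc k) = subst (countOnes r k + bit r k ≤_) (+-comm k 1) (+-mono-≤ (countOnes≤ r k) (≤-pred (bit<2 r k)))

countOnes-zero : ∀ k → countOnes 0 k ≡ ⌊ k /2⌋
countOnes-zero zero          = refl
countOnes-zero (suc zero)    = refl
countOnes-zero (suc (suc k)) = begin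
  countOnes 0 k + k % 2 + suc k % 2     ≡⟨ +-assoc (countOnes 0 k) (k % 2) (suc k % 2) ⟩
  countOnes 0 k + (k % 2 + suc k % 2)   ≡⟨ cong₂ _+_ (countOnes-zero k) (%2+[1+n]%2≡1 k) ⟩
  ⌊ k /2⌋ + 1                           ≡⟨ +-comm ⌊ k /2⌋ 1 ⟩
  suc ⌊ k /2⌋                           ∎
  where open ≡-Reasoning

-- Bit r + 1 of i is bit r of ⌊ i /2⌋, and the halves of 0, …, k - 1 are
-- 0, …, ⌈ k /2⌉ - 1 (from the even ones) and 0, …, ⌊ k /2⌋ - 1 (from the odd ones).
countOnes-suc : ∀ r k → countOnes (suc r) k ≡ countOnes r ⌈ k /2⌉ + countOnes r ⌊ k /2⌋
countOnes-suc r zero          = refl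
countOnes-suc r (suc zero)    = sym (+-identityʳ (0 + bit r 0))
countOnes-suc r (suc (suc k)) = begin
  countOnes (suc r) k + bit r ⌊ k /2⌋ + bit r ⌈ k /2⌉
    ≡⟨ cong (λ t → t + bit r ⌊ k /2⌋ + bit r ⌈ k /2⌉) (countOnes-suc r k) ⟩
  countOnes r ⌈ k /2⌉ + countOnes r ⌊ k /2⌋ + bit r ⌊ k /2⌋ + bit r ⌈ k /2⌉
    ≡⟨ regroup (countOnes r ⌈ k /2⌉) (countOnes r ⌊ k /2⌋) (bit r ⌊ k /2⌋) (bit r ⌈ k /2⌉) ⟩
  countOnes r (suc ⌈ k /2⌉) + countOnes r (suc ⌊ k /2⌋) ∎
  where
  open ≡-Reasoning
  regroup : ∀ a b c d → a + b + c + d ≡ (a + d) + (b + c)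
  regroup = solve-∀

balanced-+bit : ∀ {x c} b → b < 2 → c ≤ x → Balanced (c + b) c × Balanced (suc x ∸ (c + b)) (x ∸ c)
balanced-+bit {x} {c} zero _ c≤x rewrite +-identityʳ c | +-∸-assoc 1 c≤x = equal , oneMore
balanced-+bit {x} {c} (suc zero) _ c≤x rewrite +-comm c 1 = oneMore , equal
balanced-+bit (suc (suc _)) (s≤s (s≤s ())) _

countOnes-balanced : ∀ r {A B} → Balanced A B →
  Balanced (countOnes r A) (countOnes r B) × Balanced (A ∸ countOnes r A) (B ∸ countOnes r B)
countOnes-balanced r equal           = equal , equal
countOnes-balanced r {_} {B} oneMore = balanced-+bit (bit r B) (bit<2 r B) (countOnes≤ r B)

splits-+ : ∀ p {A B A₁ B₁} → A₁ ≤ A → B₁ ≤ B →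
  Balanced A B → Balanced A₁ B₁ → Balanced (A ∸ A₁) (B ∸ B₁) →
  Splits p A A₁ → Splits p B B₁ → Splits (p ∸ 1) B B₁ → Splits p (A + B) (A₁ + B₁)
splits-+ p {A} {B} {A₁} {B₁} A₁≤A B₁≤B AB A₁B₁ UV sA sB s′B = begin
  cubes p (A + B)
    ≡⟨ cubes-balanced p AB ⟩
  cubes p A + cubes p B + cubes q B
    ≡⟨ +-cong₃ sA sB s′B ⟩
  splitCubes p U A₁ + splitCubes p V B₁ + splitCubes q V B₁
    ≡⟨ regroup (cubes p U) (cubes p A₁) (cubes q A₁) (cubes p V) (cubes p B₁) (cubes q B₁) (cubes q V) (cubes (q ∸ 1) B₁) ⟩
  splitCubes p U V + splitCubes p A₁ B₁ + splitCubes q A₁ B₁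
    ≡⟨ +-cong₃ (cubes-balanced p UV) (cubes-balanced p A₁B₁) (cubes-balanced q A₁B₁) ⟨
  splitCubes p (U + V) (A₁ + B₁)
    ≡⟨ cong (λ t → splitCubes p t (A₁ + B₁)) ([m+n]∸[o+p]≡[m∸o]+[n∸p] A₁≤A B₁≤B) ⟨
  splitCubes p ((A + B) ∸ (A₁ + B₁)) (A₁ + B₁) ∎
  where
  open ≡-Reasoning
  q = p ∸ 1
  U = A ∸ A₁
  V = B ∸ B₁
  regroup : ∀ u a₁ a₁′ v b₁ b₁′ v′ b₁″ →
    (u + a₁ + a₁′) + (v + b₁ + b₁′) + (v′ + b₁′ + b₁″) ≡ (u + v + v′) + (a₁ + b₁ + b₁′) + (a₁′ + b₁′ + b₁″)
  regroup = solve-∀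

countOnes-splits : ∀ r p k → Splits p k (countOnes r k)
countOnes-splits zero    p k = subst (Splits p k) (sym (countOnes-zero k)) (splits-half p k)
countOnes-splits (suc r) p k = subst₂ (Splits p) (⌈n/2⌉+⌊n/2⌋≡n k) (sym (countOnes-suc r k))
  (splits-+ p (countOnes≤ r A) (countOnes≤ r B) AB ones zeros
    (countOnes-splits r p A) (countOnes-splits r p B) (countOnes-splits r (p ∸ 1) B))
  where
  A = ⌈ k /2⌉
  B = ⌊ k /2⌋
  AB = balanced-halves k
  ones  = proj₁ (countOnes-balanced r AB)
  zeros = proj₂ (countOnes-balanced r AB)

corollary1 : (n q k k₁ : ℕ) → 1 ≤ n → 1 ≤ q → q ≤ n → 2 ≤ k → k ≤ 2 ^ n →
    HypercubicPartition n k k₁ →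
    F q k ≡ F q (k ∸ k₁) + F q k₁ + F (q ∸ 1) k₁
corollary1 n (suc q) k k₁ _ _ _ _ _ (_ , _ , r , _ , ones≡k₁) = begin
  F (suc q) k
    ≡⟨ F≡cubes (suc q) k ⟩
  cubes (suc (suc q)) k
    ≡⟨ subst (Splits (suc (suc q)) k) ones≡k₁ (countOnes-splits r (suc (suc q)) k) ⟩
  splitCubes (suc (suc q)) (k ∸ k₁) k₁
    ≡⟨ +-cong₃ (F≡cubes (suc q) (k ∸ k₁)) (F≡cubes (suc q) k₁) (F≡cubes q k₁) ⟨
  F (suc q) (k ∸ k₁) + F (suc q) k₁ + F q k₁ ∎
  where open ≡-Reasoning
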